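{- Let $P=(X,\prec)$ be a finite poset and let $x\in X$. Then for every positive integer $a$ there exists an integer $T(P,x,a)>0$ such that for all $t>T(P,x,a)$, $$\Omega(P,t;x,a)^2\ \ge\ \Omega(P,t;x,a+1)\cdot\Omega(P,t;x,a-1).$$
   Context: For an integer $t\ge1$ and integer $a$, $\Omega(P,t;x,a)$ is the number of maps $g:X\to[t]$ with $g(u)\le g(v)$ whenever $u\prec v$, and $g(x)=a$. -}

module Defs where

open import Data.Nat using (ℕ; zero; suc; _≤_; _≤?_)
open import Data.Nat.Properties using (_≟_)
open import Data.Fin using (Fin; toℕ)
open import Data.Fin.Properties using (all?)
open import Data.Vec using (Vec; []; _∷_; lookup)
open import Data.List using (List; map; concatMap; length; filter; allFin)
  renaming ([] to []ₗ; _∷_ to _∷ₗ_)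
open import Data.Product using (_×_)
open import Relation.Binary using (Rel; IsDecPartialOrder)
open import Relation.Binary.PropositionalEquality using (_≡_)
open import Relation.Nullary using (Dec; _×-dec_; _→-dec_)

record FinPoset : Set₁ where
  field
    n       : ℕ
    _≼_     : Rel (Fin n) _
    isDecPO : IsDecPartialOrder _≡_ _≼_

  open IsDecPartialOrder isDecPO public using () renaming (_≤?_ to _≼?_)

open FinPoset public

-- All maps X → Fin t, enumerated as vectors (each map exactly once).
allVecs : (m t : ℕ) → List (Vec (Fin t) m)
allVecs zero    t = [] ∷ₗ []ₗ
allVecs (suc m) t = concatMap (λ i → map (i ∷_) (allVecs m t)) (allFin t)

-- value of g at u in [t] = {1,…,t}: the index i : Fin t stands for i+1
val : ∀ {m t} → Vec (Fin t) m → Fin m → ℕ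
val g u = suc (toℕ (lookup g u))

Admissible : (P : FinPoset) (t : ℕ) (x : Fin (n P)) (a : ℕ) → Vec (Fin t) (n P) → Set
Admissible P t x a g =
  (∀ u → ∀ v → _≼_ P u v → val g u ≤ val g v) × (val g x ≡ a)

admissible? : (P : FinPoset) (t : ℕ) (x : Fin (n P)) (a : ℕ) →
              (g : Vec (Fin t) (n P)) → Dec (Admissible P t x a g)
admissible? P t x a g =
  all? (λ u → all? (λ v → _≼?_ P u v →-dec (val g u ≤? val g v)))
  ×-dec (val g x ≟ a)

Ω : (P : FinPoset) (t : ℕ) (x : Fin (n P)) (a : ℕ) → ℕ
Ω P t x a = length (filter (admissible? P t x a) (allVecs (n P) t))

-- The inequality holds for every t, so T = 1 works. If g(x) = a + 1 and
-- h(x) = a − 1 are order-preserving, then so are g ∧ h = min(g, h + 1) and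
-- g ∨ h = max(g − 1, h), and both take the value a at x. With j' = j + 1 the
-- pair (min(i, j + 1), max(i − 1, j)) becomes (min(i, j'), max(i, j') − 1), so
-- after shifting the second and fourth function by one these are the lattice
-- operations of a chain, which satisfy the Ahlswede–Daykin four functions
-- inequality; the inequality lifts coordinatewise to [t]^X. Applying it to the
-- indicators of the four sets of maps counted by Ω gives Ω(a + 1) Ω(a − 1) ≤ Ω(a)².
module Submission where

open import Defs
open import Data.Nat using (ℕ; zero; suc; _≤_; _<_; _+_; _*_; _∸_; _⊓_; _⊔_; pred; z≤n; s≤s)
open import Data.Nat.Properties
open import Data.Nat.Tactic.RingSolver using (solve-∀)
open import Data.Nat.ListAction using (sum)
open import Data.Nat.ListAction.Properties using (sum-++)
open import Data.Fin as F using (Fin; toℕ; fromℕ<)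
open import Data.Fin.Properties using (toℕ-fromℕ<; toℕ<n)
open import Data.Vec using (Vec; []; _∷_; lookup; zipWith)
open import Data.Vec.Properties using (lookup-zipWith)
open import Data.List using (List; map; concatMap; length; filter; allFin; tabulate)
  renaming ([] to []ₗ; _∷_ to _∷ₗ_)
open import Data.List.Properties using (map-∘; map-cong; map-tabulate; map-concatMap)
open import Data.Product using (Σ; _×_; _,_)
open import Function using (_∘_)
open import Relation.Nullary using (Dec; yes; no; contradiction)
open import Relation.Binary.PropositionalEquality

FourFunctions : {A : Set} → ((A → ℕ) → ℕ) → (A → A → A) → (A → A → A) → Set
FourFunctions {A} ∑ _∧_ _∨_ = (α β γ δ : A → ℕ) →
  (∀ u v → α u * β v ≤ γ (u ∧ v) * δ (u ∨ v)) →
  ∑ α * ∑ β ≤ ∑ γ * ∑ δ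

z*[x+y]+[z∸x]*[z∸y]≡z*z+x*y : ∀ {x y z} → x ≤ z → y ≤ z →
  z * (x + y) + (z ∸ x) * (z ∸ y) ≡ z * z + x * y
z*[x+y]+[z∸x]*[z∸y]≡z*z+x*y {x} {y} {z} x≤z y≤z = begin
  z * (x + y) + p * q          ≡⟨ cong (_+ p * q) (*-distribˡ-+ z x y) ⟩
  z * x + z * y + p * q        ≡⟨ cong₂ (λ u v → u * x + v * y + p * q) (sym y+q≡z) (sym x+p≡z) ⟩
  (y + q) * x + (x + p) * y + p * q
                               ≡⟨ rearrange x y p q ⟩
  (x + p) * (y + q) + x * y    ≡⟨ cong₂ (λ u v → u * v + x * y) x+p≡z y+q≡z ⟩
  z * z + x * y                ∎
  where
  open ≡-Reasoning
  p = z ∸ x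
  q = z ∸ y
  x+p≡z = m+[n∸m]≡n x≤z
  y+q≡z = m+[n∸m]≡n y≤z
  rearrange : ∀ x y p q → (y + q) * x + (x + p) * y + p * q ≡ (x + p) * (y + q) + x * y
  rearrange = solve-∀

+-≤-of-*-≤ : ∀ {x y z w} → x ≤ z → y ≤ z → x * y ≤ z * w → x + y ≤ z + w
+-≤-of-*-≤ {z = zero} z≤n z≤n _ = z≤n
+-≤-of-*-≤ {x} {y} {z@(suc _)} {w} x≤z y≤z xy≤zw = *-cancelˡ-≤ z (begin
  z * (x + y)                       ≤⟨ m≤m+n _ _ ⟩
  z * (x + y) + (z ∸ x) * (z ∸ y)   ≡⟨ z*[x+y]+[z∸x]*[z∸y]≡z*z+x*y x≤z y≤z ⟩
  z * z + x * y                     ≤⟨ +-monoʳ-≤ (z * z) xy≤zw ⟩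
  z * z + z * w                     ≡⟨ *-distribˡ-+ z z w ⟨
  z * (z + w)                       ∎)
  where open ≤-Reasoning

fourFunctions-twoPoint : ∀ a₀ a₁ b₀ b₁ c₀ c₁ d₀ d₁ →
  a₀ * b₀ ≤ c₀ * d₀ → a₀ * b₁ ≤ c₀ * d₁ → a₁ * b₀ ≤ c₀ * d₁ → a₁ * b₁ ≤ c₁ * d₁ →
  (a₀ + a₁) * (b₀ + b₁) ≤ (c₀ + c₁) * (d₀ + d₁)
fourFunctions-twoPoint a₀ a₁ b₀ b₁ c₀ c₁ d₀ d₁ h₀₀ h₀₁ h₁₀ h₁₁ = begin
  (a₀ + a₁) * (b₀ + b₁)                          ≡⟨ expand a₀ a₁ b₀ b₁ ⟩
  a₀ * b₀ + (a₀ * b₁ + a₁ * b₀) + a₁ * b₁        ≤⟨ +-mono-≤ (+-mono-≤ h₀₀ middle) h₁₁ ⟩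
  c₀ * d₀ + (c₀ * d₁ + c₁ * d₀) + c₁ * d₁        ≡⟨ expand c₀ c₁ d₀ d₁ ⟨
  (c₀ + c₁) * (d₀ + d₁)                          ∎
  where
  open ≤-Reasoning
  expand : ∀ a₀ a₁ b₀ b₁ → (a₀ + a₁) * (b₀ + b₁) ≡ a₀ * b₀ + (a₀ * b₁ + a₁ * b₀) + a₁ * b₁
  expand = solve-∀
  swap : ∀ p q r s → (p * q) * (r * s) ≡ (p * s) * (r * q)
  swap = solve-∀
  middle : a₀ * b₁ + a₁ * b₀ ≤ c₀ * d₁ + c₁ * d₀
  middle = +-≤-of-*-≤ h₀₁ h₁₀ (begin
    (a₀ * b₁) * (a₁ * b₀)   ≡⟨ swap a₀ b₁ a₁ b₀ ⟩
    (a₀ * b₀) * (a₁ * b₁)   ≤⟨ *-mono-≤ h₀₀ h₁₁ ⟩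
    (c₀ * d₀) * (c₁ * d₁)   ≡⟨ swap c₀ d₀ c₁ d₁ ⟩
    (c₀ * d₁) * (c₁ * d₀)   ∎)

∑< : ℕ → (ℕ → ℕ) → ℕ
∑< zero    f = 0
∑< (suc n) f = f 0 + ∑< n (f ∘ suc)

*-∑<-mono-≤ : ∀ n k m {f g : ℕ → ℕ} → (∀ j → k * f j ≤ m * g j) → k * ∑< n f ≤ m * ∑< n g
*-∑<-mono-≤ zero    k m _ = ≤-reflexive (trans (*-zeroʳ k) (sym (*-zeroʳ m)))
*-∑<-mono-≤ (suc n) k m h = subst₂ _≤_ (sym (*-distribˡ-+ k _ _)) (sym (*-distribˡ-+ m _ _))
  (+-mono-≤ (h 0) (*-∑<-mono-≤ n k m (h ∘ suc)))

chain-fourFunctions : ∀ n → FourFunctions (∑< n) _⊓_ _⊔_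
chain-fourFunctions zero    α β γ δ h = z≤n
chain-fourFunctions (suc n) α β γ δ h =
  fourFunctions-twoPoint (α 0) (∑< n (α ∘ suc)) (β 0) (∑< n (β ∘ suc))
                         (γ 0) (∑< n (γ ∘ suc)) (δ 0) (∑< n (δ ∘ suc))
    (h 0 0)
    (*-∑<-mono-≤ n (α 0) (γ 0) (λ j → h 0 (suc j)))
    (subst (_≤ γ 0 * ∑< n (δ ∘ suc)) (*-comm (β 0) _)
      (*-∑<-mono-≤ n (β 0) (γ 0) (λ i →
        subst (_≤ γ 0 * δ (suc i)) (*-comm (α (suc i)) _) (h (suc i) 0))))
    (chain-fourFunctions n (α ∘ suc) (β ∘ suc) (γ ∘ suc) (δ ∘ suc) (λ i j → h (suc i) (suc j)))

∑Fin : ∀ {t} → (Fin t → ℕ) → ℕ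
∑Fin f = sum (tabulate f)

shiftedMin : ∀ {t} → Fin t → Fin t → Fin t
shiftedMin i j = fromℕ< (≤-<-trans (m⊓n≤m (toℕ i) (suc (toℕ j))) (toℕ<n i))

shiftedMax : ∀ {t} → Fin t → Fin t → Fin t
shiftedMax i j = fromℕ< (⊔-lub (≤-<-trans pred[n]≤n (toℕ<n i)) (toℕ<n j))

m⊔suc[n]≡suc[pred[m]⊔n] : ∀ m n → m ⊔ suc n ≡ suc (pred m ⊔ n)
m⊔suc[n]≡suc[pred[m]⊔n] zero    n = refl
m⊔suc[n]≡suc[pred[m]⊔n] (suc m) n = refl

extend : ∀ {t} → (Fin t → ℕ) → ℕ → ℕ
extend {zero}  f k       = 0
extend {suc t} f zero    = f F.zero
extend {suc t} f (suc k) = extend (f ∘ F.suc) k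

extend-toℕ : ∀ {t} (f : Fin t → ℕ) {i k} → toℕ i ≡ k → extend f k ≡ f i
extend-toℕ f {F.zero}  refl = refl
extend-toℕ f {F.suc i} refl = extend-toℕ (f ∘ F.suc) refl

extend-≥ : ∀ {t} (f : Fin t → ℕ) {k} → t ≤ k → extend f k ≡ 0
extend-≥ {zero}  f _         = refl
extend-≥ {suc t} f (s≤s t≤k) = extend-≥ (f ∘ F.suc) t≤k

∑Fin≡∑<-extend : ∀ {t} (f : Fin t → ℕ) → ∑Fin f ≡ ∑< t (extend f)
∑Fin≡∑<-extend {zero}  f = refl
∑Fin≡∑<-extend {suc t} f = cong (f F.zero +_) (∑Fin≡∑<-extend (f ∘ F.suc))

∑Fin≡∑<-suc-extend : ∀ {t} (f : Fin t → ℕ) → ∑Fin f ≡ ∑< (suc t) (extend f)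
∑Fin≡∑<-suc-extend {zero}  f = refl
∑Fin≡∑<-suc-extend {suc t} f = cong (f F.zero +_) (∑Fin≡∑<-suc-extend (f ∘ F.suc))

data InRange (t : ℕ) : ℕ → Set where
  inside  : (i : Fin t) → InRange t (toℕ i)
  outside : ∀ {k} → t ≤ k → InRange t k

inRange : ∀ t k → InRange t k
inRange zero    k    = outside z≤n
inRange (suc t) zero = inside F.zero
inRange (suc t) (suc k) with inRange t k
... | inside i      = inside (F.suc i)
... | outside t≤k   = outside (s≤s t≤k)

shiftedChain-fourFunctions : ∀ t → FourFunctions (∑Fin {t}) shiftedMin shiftedMax
shiftedChain-fourFunctions t α β γ δ h = begin
  ∑Fin α * ∑Fin β
    ≡⟨ cong₂ _*_ (∑Fin≡∑<-suc-extend α) (∑Fin≡∑<-extend β) ⟩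
  ∑< (suc t) (extend α) * ∑< (suc t) (shift (extend β))
    ≤⟨ chain-fourFunctions (suc t) (extend α) (shift (extend β)) (extend γ) (shift (extend δ)) h′ ⟩
  ∑< (suc t) (extend γ) * ∑< (suc t) (shift (extend δ))
    ≡⟨ cong₂ _*_ (∑Fin≡∑<-suc-extend γ) (∑Fin≡∑<-extend δ) ⟨
  ∑Fin γ * ∑Fin δ
    ∎
  where
  open ≤-Reasoning
  ≡0⇒≤ : ∀ {m k} → m ≡ 0 → m ≤ k
  ≡0⇒≤ refl = z≤n
  shift : (ℕ → ℕ) → ℕ → ℕ
  shift f zero    = 0
  shift f (suc k) = f k
  h′ : ∀ i j → extend α i * shift (extend β) j ≤ extend γ (i ⊓ j) * shift (extend δ) (i ⊔ j)
  h′ i zero    = ≡0⇒≤ (*-zeroʳ (extend α i))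
  h′ i (suc j) rewrite m⊔suc[n]≡suc[pred[m]⊔n] i j with inRange t i | inRange t j
  ... | outside t≤i | _           = ≡0⇒≤ (cong (_* extend β j) (extend-≥ α t≤i))
  ... | inside i′   | outside t≤j =
    ≡0⇒≤ (trans (cong (extend α (toℕ i′) *_) (extend-≥ β t≤j)) (*-zeroʳ (extend α (toℕ i′))))
  ... | inside i′   | inside j′   = subst₂ _≤_
    (sym (cong₂ _*_ (extend-toℕ α refl) (extend-toℕ β refl)))
    (sym (cong₂ _*_ (extend-toℕ γ (toℕ-fromℕ< _)) (extend-toℕ δ (toℕ-fromℕ< _))))
    (h i′ j′)

∑Vec : ∀ m {t} → (Vec (Fin t) m → ℕ) → ℕ
∑Vec m {t} f = sum (map f (allVecs m t))

sum-concatMap : ∀ {A : Set} (f : A → List ℕ) xs → sum (concatMap f xs) ≡ sum (map (sum ∘ f) xs)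
sum-concatMap f []ₗ        = refl
sum-concatMap f (x ∷ₗ xs) = trans (sum-++ (f x) (concatMap f xs)) (cong (sum (f x) +_) (sum-concatMap f xs))

∑Vec-suc : ∀ m {t} (f : Vec (Fin t) (suc m) → ℕ) → ∑Vec (suc m) f ≡ ∑Fin (λ i → ∑Vec m (f ∘ (i ∷_)))
∑Vec-suc m {t} f = begin
  sum (map f (concatMap rows (allFin t)))
    ≡⟨ cong sum (map-concatMap f rows (allFin t)) ⟩
  sum (concatMap (map f ∘ rows) (allFin t))
    ≡⟨ sum-concatMap (map f ∘ rows) (allFin t) ⟩
  sum (map (sum ∘ map f ∘ rows) (allFin t))
    ≡⟨ cong sum (map-cong (λ i → cong sum (map-∘ (allVecs m t))) (allFin t)) ⟨
  sum (map (λ i → ∑Vec m (f ∘ (i ∷_))) (allFin t))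
    ≡⟨ cong sum (map-tabulate (λ i → i) (λ i → ∑Vec m (f ∘ (i ∷_)))) ⟩
  ∑Fin (λ i → ∑Vec m (f ∘ (i ∷_)))
    ∎
  where
  open ≡-Reasoning
  rows : Fin t → List (Vec (Fin t) (suc m))
  rows i = map (i ∷_) (allVecs m t)

product-fourFunctions : ∀ {t} {_∧_ _∨_ : Fin t → Fin t → Fin t} →
  FourFunctions ∑Fin _∧_ _∨_ → ∀ m → FourFunctions (∑Vec m) (zipWith _∧_) (zipWith _∨_)
product-fourFunctions ff zero α β γ δ h =
  subst₂ _≤_ (cong₂ _*_ (sym (+-identityʳ (α []))) (sym (+-identityʳ (β []))))
             (cong₂ _*_ (sym (+-identityʳ (γ []))) (sym (+-identityʳ (δ []))))
    (h [] [])
product-fourFunctions {_∧_ = _∧_} {_∨_} ff (suc m) α β γ δ h =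
  subst₂ _≤_ (sym (cong₂ _*_ (∑Vec-suc m α) (∑Vec-suc m β)))
             (sym (cong₂ _*_ (∑Vec-suc m γ) (∑Vec-suc m δ)))
    (ff _ _ _ _ λ i j →
      product-fourFunctions ff m (α ∘ (i ∷_)) (β ∘ (j ∷_)) (γ ∘ ((i ∧ j) ∷_)) (δ ∘ ((i ∨ j) ∷_))
        (λ u v → h (i ∷ u) (j ∷ v)))

indicator : ∀ {Q : Set} → Dec Q → ℕ
indicator (yes _) = 1
indicator (no _)  = 0

length-filter≡sum-indicator : ∀ {A : Set} {Q : A → Set} (Q? : ∀ y → Dec (Q y)) xs →
  length (filter Q? xs) ≡ sum (map (indicator ∘ Q?) xs)
length-filter≡sum-indicator Q? []ₗ = refl
length-filter≡sum-indicator Q? (x ∷ₗ xs) with Q? x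
... | yes _ = cong suc (length-filter≡sum-indicator Q? xs)
... | no _  = length-filter≡sum-indicator Q? xs

indicator-*-mono-≤ : ∀ {Q₁ Q₂ R₁ R₂ : Set} (q₁ : Dec Q₁) (q₂ : Dec Q₂) (r₁ : Dec R₁) (r₂ : Dec R₂) →
  (Q₁ → Q₂ → R₁) → (Q₁ → Q₂ → R₂) → indicator q₁ * indicator q₂ ≤ indicator r₁ * indicator r₂
indicator-*-mono-≤ (no _)   _        _        _        _ _ = z≤n
indicator-*-mono-≤ (yes _)  (no _)   _        _        _ _ = z≤n
indicator-*-mono-≤ (yes q₁) (yes q₂) (yes _)  (yes _)  _ _ = s≤s z≤n
indicator-*-mono-≤ (yes q₁) (yes q₂) (no ¬r₁) _        f _ = contradiction (f q₁ q₂) ¬r₁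
indicator-*-mono-≤ (yes q₁) (yes q₂) (yes _)  (no ¬r₂) _ g = contradiction (g q₁ q₂) ¬r₂

Ω≡∑Vec-indicator : ∀ P t x a → Ω P t x a ≡ ∑Vec (n P) (indicator ∘ admissible? P t x a)
Ω≡∑Vec-indicator P t x a = length-filter≡sum-indicator (admissible? P t x a) (allVecs (n P) t)

module _ (P : FinPoset) {t : ℕ} (x : Fin (n P)) where

  Admissible-zipWith : (_◇_ : Fin t → Fin t → Fin t) (F : ℕ → ℕ → ℕ) →
    (∀ i j → suc (toℕ (i ◇ j)) ≡ F (suc (toℕ i)) (suc (toℕ j))) →
    (∀ {p q r s} → p ≤ q → r ≤ s → F p r ≤ F q s) →
    ∀ {a b} g h → Admissible P t x a g → Admissible P t x b h →
    Admissible P t x (F a b) (zipWith _◇_ g h)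
  Admissible-zipWith _◇_ F val-◇ F-mono g h (g-mono , gx≡a) (h-mono , hx≡b) =
    (λ u v u≼v → subst₂ _≤_ (sym (valAt u)) (sym (valAt v)) (F-mono (g-mono u v u≼v) (h-mono u v u≼v))) ,
    trans (valAt x) (cong₂ F gx≡a hx≡b)
    where
    valAt : ∀ u → val (zipWith _◇_ g h) u ≡ F (val g u) (val h u)
    valAt u = trans (cong (suc ∘ toℕ) (lookup-zipWith _◇_ u g h)) (val-◇ (lookup g u) (lookup h u))

  shiftedMin-admissible : ∀ {a} g h → Admissible P t x (suc (suc a)) g → Admissible P t x a h →
    Admissible P t x (suc a) (zipWith shiftedMin g h)
  shiftedMin-admissible {a} g h adm-g adm-h =
    subst (λ b → Admissible P t x b (zipWith shiftedMin g h)) (m≥n⇒m⊓n≡n (n≤1+n (suc a)))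
    (Admissible-zipWith shiftedMin (λ p q → p ⊓ suc q)
      (λ i j → cong suc (toℕ-fromℕ< _))
      (λ p≤q r≤s → ⊓-mono-≤ p≤q (s≤s r≤s))
      g h adm-g adm-h)

  shiftedMax-admissible : ∀ {a} g h → Admissible P t x (suc (suc a)) g → Admissible P t x a h →
    Admissible P t x (suc a) (zipWith shiftedMax g h)
  shiftedMax-admissible {a} g h adm-g adm-h =
    subst (λ b → Admissible P t x b (zipWith shiftedMax g h)) (m≥n⇒m⊔n≡m (n≤1+n a))
    (Admissible-zipWith shiftedMax (λ p q → pred p ⊔ q)
      (λ i j → trans (cong suc (toℕ-fromℕ< _)) (sym (m⊔suc[n]≡suc[pred[m]⊔n] (toℕ i) (toℕ j))))
      (λ p≤q r≤s → ⊔-mono-≤ (pred-mono-≤ p≤q) r≤s)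
      g h adm-g adm-h)

  Ω-logConcave : ∀ a → Ω P t x (suc (suc a)) * Ω P t x a ≤ Ω P t x (suc a) * Ω P t x (suc a)
  Ω-logConcave a = begin
    Ω P t x (suc (suc a)) * Ω P t x a
      ≡⟨ cong₂ _*_ (Ω≡∑Vec-indicator P t x (suc (suc a))) (Ω≡∑Vec-indicator P t x a) ⟩
    ∑Vec (n P) (indicator ∘ admissible? P t x (suc (suc a))) * ∑Vec (n P) (indicator ∘ admissible? P t x a)
      ≤⟨ product-fourFunctions (shiftedChain-fourFunctions t) (n P) _ _ _ _ (λ g h →
           indicator-*-mono-≤
             (admissible? P t x (suc (suc a)) g) (admissible? P t x a h)
             (admissible? P t x (suc a) (zipWith shiftedMin g h))
             (admissible? P t x (suc a) (zipWith shiftedMax g h))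
             (shiftedMin-admissible g h) (shiftedMax-admissible g h)) ⟩
    ∑Vec (n P) (indicator ∘ admissible? P t x (suc a)) * ∑Vec (n P) (indicator ∘ admissible? P t x (suc a))
      ≡⟨ cong₂ _*_ (Ω≡∑Vec-indicator P t x (suc a)) (Ω≡∑Vec-indicator P t x (suc a)) ⟨
    Ω P t x (suc a) * Ω P t x (suc a)
      ∎
    where open ≤-Reasoning

theorem4p20 : (P : FinPoset) (x : Fin (n P)) (a : ℕ) → 1 ≤ a →
    Σ ℕ (λ T → (0 < T) × ((t : ℕ) → T < t →
      Ω P t x (suc a) * Ω P t x (a ∸ 1) ≤ Ω P t x a * Ω P t x a))
theorem4p20 P x zero    ()
theorem4p20 P x (suc a) _ = 1 , s≤s z≤n , λ t _ → Ω-logConcave P x a
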